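{- Let $G$ be a graph that has a pair of false twins, has no pair of true twins, and for which there do not exist adjacent vertices $x,y$ and a vertex $z$ with $N[x]\setminus\{z\}=N[y]$ and every neighbor of $z$ lying in $N[N[x]\cap N[y]]$. Then $\kappa(G)=4$.
   Context: All graphs are finite, simple and connected; $d(u,v)$ is the distance. $N(x)$ and $N[x]=N(x)\cup\{x\}$ are the open and closed neighborhoods; for a vertex set $A$, $N[A]=\bigcup_{a\in A}N[a]$. Distinct vertices $x,y$ are false twins if $N(x)=N(y)$ and true twins if $N[x]=N[y]$. For vertices $x,y,s$ put $\Delta_s(x,y)=|d(x,s)-d(y,s)|$, $\Delta_S(x,y)=\sum_{s\in S}\Delta_s(x,y)$. For $k\ge1$, $S$ is a weak $k$-resolving set if $\Delta_S(x,y)\ge k$ for all distinct $x,y$. $\kappa(G)$ is the largest $k$ such that $G$ has a weak $k$-resolving set. -}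

module Defs where

open import Data.Nat using (ℕ; zero; suc; _≤_; ∣_-_∣)
open import Data.Bool using (Bool; true; false; _∧_; _∨_; if_then_else_)
open import Data.Fin using (Fin; _≟_)
open import Data.Fin.Subset using (Subset; Side; inside; outside)
open import Data.Vec using (lookup)
open import Data.List using (List; allFin; map)
open import Data.Bool.ListAction using (any)
open import Data.Nat.ListAction using (sum)
open import Data.Product using (Σ; ∃; _×_; _,_)
open import Data.Sum using (_⊎_)
open import Relation.Nullary using (¬_; ⌊_⌋)
open import Relation.Binary.PropositionalEquality using (_≡_; _≢_)

_⇔'_ : Set → Set → Set
A ⇔' B = (A → B) × (B → A)

reach : {n : ℕ} → (Fin n → Fin n → Bool) → ℕ → Fin n → Fin n → Bool
reach adj zero    u v = ⌊ u ≟ v ⌋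
reach {n} adj (suc k) u v =
  reach adj k u v ∨ any (λ w → adj u w ∧ reach adj k w v) (allFin n)

record Graph : Set where
  field
    n         : ℕ
    adj       : Fin n → Fin n → Bool
    symmetric : ∀ x y → adj x y ≡ adj y x
    irrefl    : ∀ x → adj x x ≡ false
    connected : ∀ u v → ∃ λ k → reach adj k u v ≡ true

open Graph public

module _ (G : Graph) where

  V : Set
  V = Fin (n G)

  E : V → V → Set
  E x y = adj G x y ≡ true

  -- distance: least k with a walk of length ≤ k (search over k = 0 … n-1,
  -- which suffices in a connected graph on n vertices)
  private
    search : V → V → ℕ → ℕ → ℕ
    search u v k zero    = k
    search u v k (suc f) = if reach (adj G) k u v then k else search u v (suc k) f

  dist : V → V → ℕ
  dist u v = search u v 0 (n G)

  InN : V → V → Set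
  InN x w = E x w

  InN[_] : V → V → Set
  InN[ x ] w = w ≡ x ⊎ E x w

  InN[N[x]∩N[y]] : V → V → V → Set
  InN[N[x]∩N[y]] x y w = ∃ λ a → (InN[ x ] a × InN[ y ] a) × InN[ a ] w

  FalseTwins : V → V → Set
  FalseTwins x y = x ≢ y × (∀ w → InN x w ⇔' InN y w)

  TrueTwins : V → V → Set
  TrueTwins x y = x ≢ y × (∀ w → InN[ x ] w ⇔' InN[ y ] w)

  Δ : V → V → V → ℕ
  Δ s x y = ∣ dist x s - dist y s ∣

  ΔS : Subset (n G) → V → V → ℕ
  ΔS S x y = sum (map term (allFin (n G)))
    where
    term : V → ℕ
    term s with lookup S s
    ... | inside  = Δ s x y
    ... | outside = 0

  WeakResolving : ℕ → Subset (n G) → Set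
  WeakResolving k S = 1 ≤ k × (∀ x y → x ≢ y → k ≤ ΔS S x y)

  κ≡ : ℕ → Set
  κ≡ k = (∃ λ S → WeakResolving k S) × (∀ j S → WeakResolving j S → j ≤ k)

  BadConfig : Set
  BadConfig = Σ V λ x → Σ V λ y → Σ V λ z →
      E x y
    × (∀ w → (InN[ x ] w × w ≢ z) ⇔' InN[ y ] w)
    × (∀ w → InN z w → InN[N[x]∩N[y]] x y w)

-- Upper bound: false twins a, b are at the same distance from every other vertex, so only a
-- and b can separate them, each by d(a, b) ≤ 2; hence Δ_S(a, b) ≤ 4 for every S.
-- Lower bound, with S = V: non-adjacent x, y are separated by 2 at both x and y.  Adjacent x, y
-- are not true twins, so some z lies in N[x] ∖ N[y], say; then x, y and z each separate x and y
-- by at least 1, and a fourth vertex doing so exists, since otherwise x, y, z form the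
-- forbidden configuration.
module Submission where

open import Defs
open import Data.Bool using (Bool; true; false; _∧_; _∨_)
open import Data.Bool.ListAction using (or)
open import Data.Bool.Properties using (T-≡; T-∨; T-∧; T-not-≡)
open import Data.Fin using (Fin; zero; suc; punchOut; _≟_)
open import Data.Fin.Properties using (any?; punchOut-injective)
open import Data.Fin.Subset using (Subset; inside; outside; ⊤)
open import Data.List using ([]; _∷_; map; allFin; tabulate)
open import Data.List.Properties using (map-tabulate; map-cong)
open import Data.List.Membership.Propositional using (_∉_; lose)
open import Data.List.Membership.Propositional.Properties using (∈-allFin)
open import Data.List.Relation.Unary.All using (All; []; _∷_)
open import Data.List.Relation.Unary.Any using (here; there; satisfied)
open import Data.List.Relation.Unary.Any.Properties using (any⁺; any⁻)
open import Data.List.Relation.Unary.Unique.Propositional using (Unique; []; _∷_)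
open import Data.Nat using (ℕ; zero; suc; _+_; _≤_; _<_; _≤′_; ≤′-refl; ≤′-step; z≤n; s≤s)
open import Data.Nat.ListAction using () renaming (sum to sumˡ)
open import Data.Nat.Properties
  using ( +-0-commutativeMonoid; +-commutativeSemigroup; +-identityʳ; +-suc
        ; +-mono-≤; +-monoˡ-≤; +-monoʳ-≤; ≤-refl; ≤-reflexive; ≤-trans; ≤-antisym; ≤-<-trans
        ; ≤∧≢⇒<; ≤⇒≤′; ≰⇒>; <⇒≱; n≮n; n≤0⇒n≡0; n≢0⇒n>0; m<n⇒n≢0
        ; ∣-∣-comm; ∣-∣-identityʳ; ∣m-n∣≡0⇒m≡n; m≡n⇒∣m-n∣≡0; module ≤-Reasoning )
  renaming (_≟_ to _≟ℕ_)
open import Algebra.Properties.CommutativeMonoid.Sum +-0-commutativeMonoid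
  using (sum-cong-≗; sum-replicate-zero) renaming (sum to ∑)
open import Algebra.Properties.CommutativeSemigroup +-commutativeSemigroup using (x∙yz≈y∙xz)
open import Data.Product using (∃; _×_; _,_; proj₁; proj₂)
open import Data.Sum using (_⊎_; inj₁; inj₂; [_,_])
open import Data.Vec.Functional using (Vector; updateAt)
open import Data.Vec.Functional.Properties using (updateAt-updates; updateAt-minimal)
open import Data.Vec using (lookup)
open import Data.Vec.Properties using (lookup-replicate)
open import Function using (_∘_; id; const; Equivalence)
open import Relation.Binary.PropositionalEquality
  using (_≡_; _≢_; refl; sym; trans; cong; cong₂; subst; module ≡-Reasoning)
open import Relation.Nullary using (¬_; yes; no; Dec; contradiction)
open import Relation.Nullary.Decidable
  using (¬?; _×-dec_; _⊎-dec_; toWitness; fromWitness; fromWitnessFalse; decidable-stable)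

open Equivalence using (to; from)

erase : ∀ {n} → Vector ℕ n → Fin n → Vector ℕ n
erase f i = updateAt f i (const 0)

∑-erase : ∀ {n} (f : Vector ℕ n) i → ∑ f ≡ f i + ∑ (erase f i)
∑-erase f zero    = refl
∑-erase f (suc i) =
  trans (cong (f zero +_) (∑-erase (f ∘ suc) i)) (x∙yz≈y∙xz (f zero) (f (suc i)) _)

map-erase : ∀ {n} (f : Vector ℕ n) {i is} → All (i ≢_) is → map (erase f i) is ≡ map f is
map-erase f []             = refl
map-erase f {i} (i≢j ∷ ps) = cong₂ _∷_ (updateAt-minimal _ i f (i≢j ∘ sym)) (map-erase f ps)

∑-distinct-≤ : ∀ {n} (f : Vector ℕ n) {is} → Unique is → sumˡ (map f is) ≤ ∑ f
∑-distinct-≤ f []                  = z≤n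
∑-distinct-≤ f {i ∷ is} (i∉is ∷ u) = begin
  f i + sumˡ (map f is)            ≡⟨ cong (λ xs → f i + sumˡ xs) (sym (map-erase f i∉is)) ⟩
  f i + sumˡ (map (erase f i) is)  ≤⟨ +-monoʳ-≤ (f i) (∑-distinct-≤ (erase f i) u) ⟩
  f i + ∑ (erase f i)              ≡⟨ sym (∑-erase f i) ⟩
  ∑ f                              ∎
  where open ≤-Reasoning

∑-supported : ∀ {n} (f : Vector ℕ n) {is} → Unique is → (∀ s → s ∉ is → f s ≡ 0) →
              ∑ f ≡ sumˡ (map f is)
∑-supported {n} f [] vanish = trans (sum-cong-≗ (λ s → vanish s λ ())) (sum-replicate-zero n)
∑-supported f {i ∷ is} (i∉is ∷ u) vanish = begin
  ∑ f                             ≡⟨ ∑-erase f i ⟩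
  f i + ∑ (erase f i)             ≡⟨ cong (f i +_) (∑-supported (erase f i) u erase-vanish) ⟩
  f i + sumˡ (map (erase f i) is) ≡⟨ cong (λ xs → f i + sumˡ xs) (map-erase f i∉is) ⟩
  f i + sumˡ (map f is)           ∎
  where
  open ≡-Reasoning
  erase-vanish : ∀ s → s ∉ is → erase f i s ≡ 0
  erase-vanish s s∉is with s ≟ i
  ... | yes refl = updateAt-updates i f
  ... | no s≢i   = trans (updateAt-minimal s i f s≢i)
                         (vanish s λ { (here s≡i) → s≢i s≡i ; (there s∈is) → s∉is s∈is })

sumˡ-allFin : ∀ {n} (f : Vector ℕ n) → sumˡ (map f (allFin n)) ≡ ∑ f
sumˡ-allFin f = trans (cong sumˡ (map-tabulate id f)) (sumˡ-tabulate f)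
  where
  sumˡ-tabulate : ∀ {n} (f : Vector ℕ n) → sumˡ (tabulate f) ≡ ∑ f
  sumˡ-tabulate {zero}  f = refl
  sumˡ-tabulate {suc n} f = cong (f zero +_) (sumˡ-tabulate (f ∘ suc))

nonempty⇒0< : ∀ {n} → Fin n → 0 < n
nonempty⇒0< zero    = s≤s z≤n
nonempty⇒0< (suc _) = s≤s z≤n

distinct₂⇒1< : ∀ {n} {i j : Fin n} → i ≢ j → 1 < n
distinct₂⇒1< {suc n} i≢j = s≤s (nonempty⇒0< (punchOut i≢j))

distinct₃⇒2< : ∀ {n} {i j k : Fin n} → i ≢ j → i ≢ k → j ≢ k → 2 < n
distinct₃⇒2< {suc n} i≢j i≢k j≢k = s≤s (distinct₂⇒1< (j≢k ∘ punchOut-injective i≢j i≢k))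

module _ {n : ℕ} (adj : Fin n → Fin n → Bool) where

  reach-refl : ∀ u → reach adj 0 u u ≡ true
  reach-refl u = to T-≡ (fromWitness refl)

  reach-zero⁻ : ∀ {u v} → reach adj 0 u v ≡ true → u ≡ v
  reach-zero⁻ r = toWitness (from T-≡ r)

  reach-zero-≢ : ∀ {u v} → u ≢ v → reach adj 0 u v ≡ false
  reach-zero-≢ u≢v = to T-not-≡ (fromWitnessFalse u≢v)

  reach-weaken : ∀ {k u v} → reach adj k u v ≡ true → reach adj (suc k) u v ≡ true
  reach-weaken r = to T-≡ (from T-∨ (inj₁ (from T-≡ r)))

  reach-mono : ∀ {j k u v} → j ≤ k → reach adj j u v ≡ true → reach adj k u v ≡ true
  reach-mono j≤k = go (≤⇒≤′ j≤k)
    where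
    go : ∀ {j k u v} → j ≤′ k → reach adj j u v ≡ true → reach adj k u v ≡ true
    go ≤′-refl     r = r
    go {k = suc k} {u} {v} (≤′-step p) r = reach-weaken {k} {u} {v} (go p r)

  reach-step : ∀ {k u w v} → adj u w ≡ true → reach adj k w v ≡ true → reach adj (suc k) u v ≡ true
  reach-step {w = w} u~w r =
    to T-≡ (from T-∨ (inj₂ (any⁺ _ (lose (∈-allFin w) (from T-∧ (from T-≡ u~w , from T-≡ r))))))

  reach-edge : ∀ {u v} → adj u v ≡ true → reach adj 1 u v ≡ true
  reach-edge {u} {v} u~v = reach-step {0} {u} {v} {v} u~v (reach-refl v)

  reach-path₂ : ∀ {u w v} → adj u w ≡ true → adj w v ≡ true → reach adj 2 u v ≡ true
  reach-path₂ {u} {w} {v} u~w w~v = reach-step {1} {u} {w} {v} u~w (reach-edge w~v)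

  reach-suc⁻ : ∀ {k u v} → reach adj (suc k) u v ≡ true →
               reach adj k u v ≡ true ⊎ ∃ λ w → adj u w ≡ true × reach adj k w v ≡ true
  reach-suc⁻ {k} {u} {v} r with reach adj k u v
  ... | true  = inj₁ refl
  ... | false with satisfied (any⁻ _ (allFin n) (from T-≡ r))
  ...   | w , u~w∧r = inj₂ (w , to T-≡ (proj₁ (to T-∧ u~w∧r)) , to T-≡ (proj₂ (to T-∧ u~w∧r)))

  reach-one⁻ : ∀ {u v} → reach adj 1 u v ≡ true → u ≡ v ⊎ adj u v ≡ true
  reach-one⁻ {u} {v} r with reach-suc⁻ {0} {u} {v} r
  ... | inj₁ r₀             = inj₁ (reach-zero⁻ r₀)
  ... | inj₂ (w , u~w , r₀) = inj₂ (subst (λ t → adj u t ≡ true) (reach-zero⁻ r₀) u~w)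

  reach-two⁻ : ∀ {u v} → reach adj 2 u v ≡ true →
               reach adj 1 u v ≡ true ⊎ ∃ λ a → adj u a ≡ true × adj a v ≡ true
  reach-two⁻ {u} {v} r with reach-suc⁻ {1} {u} {v} r
  ... | inj₁ r₁ = inj₁ r₁
  ... | inj₂ (a , u~a , r₁) with reach-one⁻ {a} {v} r₁
  ...   | inj₁ refl = inj₁ (reach-edge u~a)
  ...   | inj₂ a~v  = inj₂ (a , u~a , a~v)

  reach-neighbour : ∀ {k u v} → reach adj k u v ≡ true → u ≢ v → ∃ λ w → adj u w ≡ true
  reach-neighbour {zero}  r u≢v = contradiction (reach-zero⁻ r) u≢v
  reach-neighbour {suc k} {u} {v} r u≢v with reach-suc⁻ {k} {u} {v} r
  ... | inj₁ r′           = reach-neighbour {k} r′ u≢v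
  ... | inj₂ (w , u~w , _) = w , u~w

  reach-cong : ∀ {u u′ v} → (∀ w → adj u w ≡ adj u′ w) → reach adj 0 u v ≡ reach adj 0 u′ v →
               ∀ k → reach adj k u v ≡ reach adj k u′ v
  reach-cong same base zero    = base
  reach-cong {v = v} same base (suc k) =
    cong₂ _∨_ (reach-cong same base k)
              (cong or (map-cong (λ w → cong (_∧ reach adj k w v) (same w)) (allFin n)))

-- Defs.dist runs a private search for the least k < n with reach k; we recover that search
-- function by unification, through a with-abstraction of the fuel n G.  The abstraction is
-- only well typed when no variable in scope has a type mentioning n G, whence Vertex.
record Vertex (G : Graph) : Set where
  constructor ⟨_⟩
  field vertex : V G

open Vertex

module _ {G : Graph} where

  E? : ∀ u v → Dec (E G u v)
  E? u v = adj G u v Data.Bool.≟ true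

  N[_]? : ∀ u w → Dec (InN[_] G u w)
  N[ u ]? w = (w ≟ u) ⊎-dec E? u w

  E-sym : ∀ {u v} → E G u v → E G v u
  E-sym {u} {v} u~v = trans (symmetric G v u) u~v

  E⇒≢ : ∀ {u v} → E G u v → u ≢ v
  E⇒≢ {u} u~u refl = contradiction (trans (sym (irrefl G u)) u~u) λ ()

  mutual
    search : V G → V G → ℕ → ℕ → ℕ
    search u v = _

    dist≡search⟨⟩ : ∀ (p q : Vertex G) →
                    dist G (vertex p) (vertex q) ≡ search (vertex p) (vertex q) 0 (n G)
    dist≡search⟨⟩ p q with 0 | n G
    ... | k | fuel = refl

  dist≡search : ∀ u v → dist G u v ≡ search u v 0 (n G)
  dist≡search u v = dist≡search⟨⟩ ⟨ u ⟩ ⟨ v ⟩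

  search-minimal : ∀ {u v j} → reach (adj G) j u v ≡ true →
                   ∀ k fuel → k ≤ j → search u v k fuel ≤ j
  search-minimal r k zero k≤j = k≤j
  search-minimal {u} {v} {j} r k (suc fuel) k≤j with reach (adj G) k u v in reached
  ... | true  = k≤j
  ... | false = search-minimal r (suc k) fuel (≤∧≢⇒< k≤j k≢j)
    where
    k≢j : k ≢ j
    k≢j refl = contradiction (trans (sym reached) r) λ ()

  search-found : ∀ {u v} k fuel →
                 search u v k fuel ≡ k + fuel ⊎ reach (adj G) (search u v k fuel) u v ≡ true
  search-found k zero = inj₁ (sym (+-identityʳ k))
  search-found {u} {v} k (suc fuel) with reach (adj G) k u v in reached
  ... | true  = inj₂ reached
  ... | false with search-found (suc k) fuel
  ...   | inj₁ exhausted = inj₁ (trans exhausted (sym (+-suc k fuel)))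
  ...   | inj₂ found     = inj₂ found

  search-cong : ∀ {u u′ v} → (∀ k → reach (adj G) k u v ≡ reach (adj G) k u′ v) →
                ∀ k fuel → search u v k fuel ≡ search u′ v k fuel
  search-cong same k zero = refl
  search-cong {u′ = u′} {v} same k (suc fuel) rewrite same k with reach (adj G) k u′ v
  ... | true  = refl
  ... | false = search-cong same (suc k) fuel

  dist-minimal : ∀ {u v j} → reach (adj G) j u v ≡ true → dist G u v ≤ j
  dist-minimal {u} {v} r = subst (_≤ _) (sym (dist≡search u v)) (search-minimal r 0 (n G) z≤n)

  -- When no k < n G is reached, dist returns the exhausted fuel n G.
  dist-reach : ∀ {u v} → dist G u v < n G → reach (adj G) (dist G u v) u v ≡ true
  dist-reach {u} {v} d<n rewrite dist≡search u v with search-found {u} {v} 0 (n G)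
  ... | inj₁ exhausted = contradiction (subst (_< n G) exhausted d<n) (n≮n (n G))
  ... | inj₂ found     = found

  dist-cong : ∀ {u u′ v} → (∀ k → reach (adj G) k u v ≡ reach (adj G) k u′ v) →
              dist G u v ≡ dist G u′ v
  dist-cong same = search-cong same 0 (n G)

  dist-≤⇒reach : ∀ {u v j} → dist G u v ≤ j → j < n G → reach (adj G) j u v ≡ true
  dist-≤⇒reach d≤j j<n = reach-mono (adj G) d≤j (dist-reach (≤-<-trans d≤j j<n))

  dist-self : ∀ u → dist G u u ≡ 0
  dist-self u = n≤0⇒n≡0 (dist-minimal (reach-refl (adj G) u))

  dist-≤2 : ∀ {u w v} → E G u w → E G w v → dist G u v ≤ 2
  dist-≤2 u~w w~v = dist-minimal (reach-path₂ (adj G) u~w w~v)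

  dist≤1⇒≡⊎E : ∀ {u v} → dist G u v ≤ 1 → u ≡ v ⊎ E G u v
  dist≤1⇒≡⊎E {u} {v} d≤1 with u ≟ v
  ... | yes u≡v = inj₁ u≡v
  ... | no u≢v  = reach-one⁻ (adj G) (dist-≤⇒reach d≤1 (distinct₂⇒1< u≢v))

  dist-≥1 : ∀ {u v} → u ≢ v → 1 ≤ dist G u v
  dist-≥1 {u} u≢v = ≰⇒> λ d≤0 → u≢v (reach-zero⁻ (adj G) (dist-≤⇒reach d≤0 (nonempty⇒0< u)))

  dist-edge : ∀ {u v} → E G u v → dist G u v ≡ 1
  dist-edge u~v = ≤-antisym (dist-minimal (reach-edge (adj G) u~v)) (dist-≥1 (E⇒≢ u~v))

  dist-≥2 : ∀ {u v} → u ≢ v → ¬ E G u v → 2 ≤ dist G u v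
  dist-≥2 u≢v u≁v = ≰⇒> λ d≤1 → [ u≢v , u≁v ] (dist≤1⇒≡⊎E d≤1)

  dist≡2⇒common-neighbour : ∀ {u v} → dist G u v ≡ 2 → 2 < n G → ∃ λ a → E G u a × E G a v
  dist≡2⇒common-neighbour d≡2 2<n with reach-two⁻ (adj G) (dist-≤⇒reach (≤-reflexive d≡2) 2<n)
  ... | inj₁ r₁     = contradiction (subst (_≤ 1) d≡2 (dist-minimal r₁)) λ { (s≤s ()) }
  ... | inj₂ common = common

  equidistant-neighbour : ∀ {u v w} → dist G u w ≡ dist G v w → E G u w → InN[_] G v w
  equidistant-neighbour d≡ u~w with dist≤1⇒≡⊎E (≤-reflexive (trans (sym d≡) (dist-edge u~w)))
  ... | inj₁ v≡w = inj₁ (sym v≡w)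
  ... | inj₂ v~w = inj₂ v~w

  N[u]∖N[v]⇒edge : ∀ {u v z} → E G v u → InN[_] G u z → ¬ InN[_] G v z → E G u z
  N[u]∖N[v]⇒edge v~u (inj₁ refl) z∉N[v] = contradiction (inj₂ v~u) z∉N[v]
  N[u]∖N[v]⇒edge _   (inj₂ u~z)  _      = u~z

  ¬TrueTwins⇒separator : ∀ {x y} → x ≢ y → ¬ TrueTwins G x y →
    ∃ λ z → (InN[_] G x z × ¬ InN[_] G y z) ⊎ (InN[_] G y z × ¬ InN[_] G x z)
  ¬TrueTwins⇒separator {x} {y} x≢y ¬twins
    with any? (λ z → (N[ x ]? z ×-dec ¬? (N[ y ]? z)) ⊎-dec (N[ y ]? z ×-dec ¬? (N[ x ]? z)))
  ... | yes separator = separator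
  ... | no none = contradiction (x≢y , λ w → N[x]⇒N[y] w , N[y]⇒N[x] w) ¬twins
    where
    N[x]⇒N[y] : ∀ w → InN[_] G x w → InN[_] G y w
    N[x]⇒N[y] w w∈N[x] = decidable-stable (N[ y ]? w) λ w∉N[y] → none (w , inj₁ (w∈N[x] , w∉N[y]))
    N[y]⇒N[x] : ∀ w → InN[_] G y w → InN[_] G x w
    N[y]⇒N[x] w w∈N[y] = decidable-stable (N[ x ]? w) λ w∉N[x] → none (w , inj₂ (w∈N[y] , w∉N[x]))

  ΔV : V G → V G → ℕ
  ΔV x y = ∑ (λ s → Δ G s x y)

  ΔV-sym : ∀ x y → ΔV x y ≡ ΔV y x
  ΔV-sym x y = sum-cong-≗ (λ s → ∣-∣-comm (dist G x s) (dist G y s))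

  Δ-left : ∀ x y → Δ G x x y ≡ dist G y x
  Δ-left x y rewrite dist-self x = refl

  Δ-right : ∀ x y → Δ G y x y ≡ dist G x y
  Δ-right x y rewrite dist-self y = ∣-∣-identityʳ (dist G x y)

  Δ-positive : ∀ {s x y} → dist G x s ≢ dist G y s → 1 ≤ Δ G s x y
  Δ-positive d≢ = n≢0⇒n>0 (d≢ ∘ ∣m-n∣≡0⇒m≡n)

  -- The summand of Defs.ΔS is bound in a where block; as for dist, unification recovers it.
  mutual
    ΔS-summand : Subset (n G) → V G → V G → V G → ℕ
    ΔS-summand S x y = _

    ΔS≡∑summand : ∀ S x y → ΔS G S x y ≡ ∑ (ΔS-summand S x y)
    ΔS≡∑summand S x y = sumˡ-allFin (ΔS-summand S x y)

  ΔS-summand-≤ : ∀ S x y s → ΔS-summand S x y s ≤ Δ G s x y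
  ΔS-summand-≤ S x y s with lookup S s
  ... | inside  = ≤-refl
  ... | outside = z≤n

  ΔS-⊤ : ∀ x y → ΔS G ⊤ x y ≡ ΔV x y
  ΔS-⊤ x y = trans (ΔS≡∑summand ⊤ x y) (sum-cong-≗ summand-⊤)
    where
    summand-⊤ : ∀ s → ΔS-summand ⊤ x y s ≡ Δ G s x y
    summand-⊤ s rewrite lookup-replicate s inside = refl

  module _ {a b : V G} (twins : FalseTwins G a b) where

    twins-adj : ∀ w → adj G a w ≡ adj G b w
    twins-adj w with adj G a w in a~w | adj G b w in b~w
    ... | true  | true  = refl
    ... | false | false = refl
    ... | true  | false = contradiction (trans (sym b~w) (proj₁ (proj₂ twins w) a~w)) λ ()
    ... | false | true  = contradiction (trans (sym a~w) (proj₂ (proj₂ twins w) b~w)) λ ()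

    twins-dist : ∀ {s} → s ≢ a → s ≢ b → dist G a s ≡ dist G b s
    twins-dist s≢a s≢b =
      dist-cong (reach-cong (adj G) twins-adj
        (trans (reach-zero-≢ (adj G) (s≢a ∘ sym)) (sym (reach-zero-≢ (adj G) (s≢b ∘ sym)))))

    twins-common-neighbour : ∃ λ w → E G a w × E G b w
    twins-common-neighbour =
      let k , a⇝b = connected G a b
          w , a~w = reach-neighbour (adj G) {k} a⇝b (proj₁ twins)
      in  w , a~w , proj₁ (proj₂ twins w) a~w

    twins-ΔS-≤4 : ∀ S → ΔS G S a b ≤ 4
    twins-ΔS-≤4 S = begin
      ΔS G S a b                     ≡⟨ ΔS≡∑summand S a b ⟩
      ∑ summand                      ≡⟨ ∑-supported summand ((proj₁ twins ∷ []) ∷ [] ∷ []) vanish ⟩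
      summand a + (summand b + 0)    ≤⟨ +-mono-≤ (Δ≤2 a (Δ-left a b) b~w a~w)
                                          (+-monoˡ-≤ 0 (Δ≤2 b (Δ-right a b) a~w b~w)) ⟩
      2 + (2 + 0)                    ∎
      where
      open ≤-Reasoning
      summand = ΔS-summand S a b
      w = proj₁ twins-common-neighbour
      a~w = proj₁ (proj₂ twins-common-neighbour)
      b~w = proj₂ (proj₂ twins-common-neighbour)
      Δ≤2 : ∀ s {u v} → Δ G s a b ≡ dist G u v → E G u w → E G v w → summand s ≤ 2
      Δ≤2 s Δ≡d u~w v~w =
        ≤-trans (ΔS-summand-≤ S a b s) (subst (_≤ 2) (sym Δ≡d) (dist-≤2 u~w (E-sym v~w)))
      vanish : ∀ s → s ∉ a ∷ b ∷ [] → summand s ≡ 0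
      vanish s s∉ = n≤0⇒n≡0 (≤-trans (ΔS-summand-≤ S a b s)
                      (≤-reflexive (m≡n⇒∣m-n∣≡0 (twins-dist (s∉ ∘ here) (s∉ ∘ there ∘ here)))))

  module _ {x y z : V G} (x~y : E G x y) (x~z : E G x z) (z∉N[y] : ¬ InN[_] G y z)
           (equidistant : ∀ w → w ≢ x → w ≢ y → w ≢ z → dist G x w ≡ dist G y w) where

    private
      y≁z : ¬ E G y z
      y≁z = z∉N[y] ∘ inj₂

    N[y]⇒N[x]∖z : ∀ {w} → InN[_] G y w → InN[_] G x w × w ≢ z
    N[y]⇒N[x]∖z (inj₁ refl)    = inj₂ x~y , z∉N[y] ∘ inj₁ ∘ sym
    N[y]⇒N[x]∖z {w} (inj₂ y~w) = w∈N[x] , w≢z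
      where
      w≢z : w ≢ z
      w≢z refl = y≁z y~w
      w∈N[x] : InN[_] G x w
      w∈N[x] with w ≟ x
      ... | yes w≡x = inj₁ w≡x
      ... | no w≢x  = equidistant-neighbour (sym (equidistant w w≢x (E⇒≢ y~w ∘ sym) w≢z)) y~w

    N[x]∖z⇒N[y] : ∀ {w} → InN[_] G x w × w ≢ z → InN[_] G y w
    N[x]∖z⇒N[y] (inj₁ refl , _)      = inj₂ (E-sym x~y)
    N[x]∖z⇒N[y] {w} (inj₂ x~w , w≢z) with w ≟ y
    ... | yes w≡y = inj₁ w≡y
    ... | no w≢y  = equidistant-neighbour (equidistant w (E⇒≢ x~w ∘ sym) w≢y w≢z) x~w

    N[z]⇒N[N[x]∩N[y]] : ∀ {w} → E G z w → InN[N[x]∩N[y]] G x y w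
    N[z]⇒N[N[x]∩N[y]] {w} z~w with w ≟ x | w ≟ y | w ≟ z
    ... | yes refl | _        | _        = x , (inj₁ refl , inj₂ (E-sym x~y)) , inj₁ refl
    ... | no _     | yes refl | _        = contradiction (E-sym z~w) y≁z
    ... | no _     | no _     | yes refl = contradiction refl (E⇒≢ z~w)
    ... | no w≢x   | no w≢y   | no w≢z with E? x w
    ...   | yes x~w = w , (inj₂ x~w , N[x]∖z⇒N[y] (inj₂ x~w , w≢z)) , inj₁ refl
    ...   | no x≁w  =
      let a , y~a , a~w = dist≡2⇒common-neighbour (trans (sym (equidistant w w≢x w≢y w≢z)) dist-x-w)
                                                  (distinct₃⇒2< (E⇒≢ x~y) (w≢x ∘ sym) (w≢y ∘ sym))
      in  a , (proj₁ (N[y]⇒N[x]∖z (inj₂ y~a)) , inj₂ y~a) , inj₂ a~w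
      where
      dist-x-w : dist G x w ≡ 2
      dist-x-w = ≤-antisym (dist-≤2 x~z z~w) (dist-≥2 (w≢x ∘ sym) x≁w)

    equidistant⇒BadConfig : BadConfig G
    equidistant⇒BadConfig =
      x , y , z , x~y , (λ w → N[x]∖z⇒N[y] , N[y]⇒N[x]∖z) , λ w → N[z]⇒N[N[x]∩N[y]]

  ΔV-≥4-nonadjacent : ∀ {x y} → x ≢ y → ¬ E G x y → 4 ≤ ΔV x y
  ΔV-≥4-nonadjacent {x} {y} x≢y x≁y =
    ≤-trans (+-mono-≤ (subst (2 ≤_) (sym (Δ-left x y)) (dist-≥2 (x≢y ∘ sym) (x≁y ∘ E-sym)))
                      (+-monoˡ-≤ 0 (subst (2 ≤_) (sym (Δ-right x y)) (dist-≥2 x≢y x≁y))))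
            (∑-distinct-≤ (λ s → Δ G s x y) ((x≢y ∷ []) ∷ [] ∷ []))

  ΔV-≥4-adjacent : ∀ {x y z} → ¬ BadConfig G → E G x y → E G x z → ¬ InN[_] G y z → 4 ≤ ΔV x y
  ΔV-≥4-adjacent {x} {y} {z} ¬bad x~y x~z z∉N[y]
    with any? (λ w → ¬? (w ≟ x) ×-dec ¬? (w ≟ y) ×-dec ¬? (w ≟ z)
                     ×-dec ¬? (dist G x w ≟ℕ dist G y w))
  ... | no none = contradiction (equidistant⇒BadConfig x~y x~z z∉N[y] equidistant) ¬bad
    where
    equidistant : ∀ w → w ≢ x → w ≢ y → w ≢ z → dist G x w ≡ dist G y w
    equidistant w w≢x w≢y w≢z =
      decidable-stable (dist G x w ≟ℕ dist G y w) λ d≢ → none (w , w≢x , w≢y , w≢z , d≢)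
  ... | yes (w , w≢x , w≢y , w≢z , separates) =
    ≤-trans (+-mono-≤ (Δ-positive separates-at-x)
              (+-mono-≤ (Δ-positive separates-at-y)
                (+-mono-≤ (Δ-positive separates-at-z) (+-mono-≤ (Δ-positive separates) z≤n))))
            (∑-distinct-≤ (λ s → Δ G s x y) distinct)
    where
    x≢y = E⇒≢ x~y
    z≢y = z∉N[y] ∘ inj₁
    separates-at-x : dist G x x ≢ dist G y x
    separates-at-x d≡ = contradiction (trans (sym d≡) (dist-self x)) (m<n⇒n≢0 (dist-≥1 (x≢y ∘ sym)))
    separates-at-y : dist G x y ≢ dist G y y
    separates-at-y d≡ = contradiction (trans d≡ (dist-self y)) (m<n⇒n≢0 (dist-≥1 x≢y))
    separates-at-z : dist G x z ≢ dist G y z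
    separates-at-z d≡ =
      <⇒≱ (dist-≥2 (z≢y ∘ sym) (z∉N[y] ∘ inj₂)) (≤-reflexive (trans (sym d≡) (dist-edge x~z)))
    distinct : Unique (x ∷ y ∷ z ∷ w ∷ [])
    distinct = (x≢y ∷ E⇒≢ x~z ∷ (w≢x ∘ sym) ∷ [])
             ∷ ((z≢y ∘ sym) ∷ (w≢y ∘ sym) ∷ [])
             ∷ ((w≢z ∘ sym) ∷ [])
             ∷ [] ∷ []

  ΔV-≥4 : ¬ (∃ λ x → ∃ λ y → TrueTwins G x y) → ¬ BadConfig G → ∀ {x y} → x ≢ y → 4 ≤ ΔV x y
  ΔV-≥4 ¬trueTwins ¬bad {x} {y} x≢y with E? x y
  ... | no x≁y  = ΔV-≥4-nonadjacent x≢y x≁y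
  ... | yes x~y with ¬TrueTwins⇒separator x≢y (λ twins → ¬trueTwins (x , y , twins))
  ...   | z , inj₁ (z∈N[x] , z∉N[y]) =
    ΔV-≥4-adjacent ¬bad x~y (N[u]∖N[v]⇒edge (E-sym x~y) z∈N[x] z∉N[y]) z∉N[y]
  ...   | z , inj₂ (z∈N[y] , z∉N[x]) =
    subst (4 ≤_) (ΔV-sym y x)
          (ΔV-≥4-adjacent ¬bad (E-sym x~y) (N[u]∖N[v]⇒edge x~y z∈N[y] z∉N[x]) z∉N[x])

corollary3p1 : (G : Graph)
    → (∃ λ x → ∃ λ y → FalseTwins G x y)
    → ¬ (∃ λ x → ∃ λ y → TrueTwins G x y)
    → ¬ BadConfig G
    → κ≡ G 4
corollary3p1 G (a , b , twins) ¬trueTwins ¬bad =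
    (⊤ , s≤s z≤n , λ x y x≢y → subst (4 ≤_) (sym (ΔS-⊤ x y)) (ΔV-≥4 ¬trueTwins ¬bad x≢y))
  , λ j S (_ , j-resolving) → ≤-trans (j-resolving a b (proj₁ twins)) (twins-ΔS-≤4 twins S)
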